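{- Let $(\sigma_0,\sigma_1,\dots,\sigma_t)$ be a sequence of swaps. If $\sigma_t^T(o_i)=j$, then exactly $|j-i|$ swaps in the sequence include $o_i$; moreover, in all these $|j-i|$ swaps, $o_i$ is moved to the right side if $i<j$, and to the left side if $i>j$.
   Context: Agents $N=\{1,\dots,n\}$ lie on a path in this order (edges between $i$ and $i+1$); objects $O=\{o_1,\dots,o_n\}$; each agent $i$ has a strict preference $\succ_i$ (a linear order on $O$); the initial assignment is $\sigma_0(i)=o_i$. A swap exchanges the objects of two adjacent agents $i,i+1$ in an assignment $\sigma$ and is allowed only if $\sigma(i+1)\succ_i\sigma(i)$ and $\sigma(i)\succ_{i+1}\sigma(i+1)$. A sequence of swaps $(\sigma_0,\dots,\sigma_t)$ starts at the initial assignment and each $\sigma_r$ arises from $\sigma_{r-1}$ by an allowed swap. $\sigma^T(o)$ denotes the agent holding $o$ in $\sigma$. A swap includes an object if that object is one of the two exchanged; an object is moved to the right side (left side) if it moves from agent $i$ to $i+1$ (to $i-1$). -}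

module Defs where

open import Level using (0ℓ)
open import Data.Nat using (ℕ; suc; _+_)
open import Data.Fin using (Fin; toℕ; _≟_)
open import Data.Product using (_×_)
open import Data.Sum using (_⊎_)
open import Data.Unit using (⊤)
open import Relation.Nullary using (does)
open import Data.Bool using (if_then_else_; _∨_)
open import Relation.Binary using (Rel; IsStrictTotalOrder)
open import Relation.Binary.PropositionalEquality using (_≡_)

-- Agents and objects are both indexed by Fin n; object o_k is represented by k.
-- A preference profile: agent a strictly prefers x to y iff  Pref a x y  ("x ≻_a y").
record Profile (n : ℕ) : Set₁ where
  field
    _prefers_over_ : Fin n → Fin n → Fin n → Set
    strict-linear : ∀ a → IsStrictTotalOrder _≡_ (_prefers_over_ a)
open Profile public

-- An assignment maps each agent to the object it holds.
Assign : ℕ → Set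
Assign n = Fin n → Fin n

σ₀ : ∀ {n} → Assign n
σ₀ i = i

Adjacent : ∀ {n} → Fin n → Fin n → Set
Adjacent i j = toℕ j ≡ suc (toℕ i)

swapAt : ∀ {n} → Assign n → Fin n → Fin n → Assign n
swapAt σ i j a =
  if does (a ≟ i) then σ j else (if does (a ≟ j) then σ i else σ a)

AllowedSwap : ∀ {n} → Profile n → Assign n → Fin n → Fin n → Set
AllowedSwap P σ i j =
  Adjacent i j × (_prefers_over_ P i (σ j) (σ i)) × (_prefers_over_ P j (σ i) (σ j))

data SwapSeq {n : ℕ} (P : Profile n) : Assign n → Set where
  start : SwapSeq P σ₀
  step  : ∀ {σ} → SwapSeq P σ → (i j : Fin n) → AllowedSwap P σ i j →
          SwapSeq P (swapAt σ i j)

countIncl : ∀ {n} {P : Profile n} {σ} → Fin n → SwapSeq P σ → ℕ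
countIncl o start = 0
countIncl {σ = _} o (step {σ} s i j _) =
  (if does (σ i ≟ o) ∨ does (σ j ≟ o) then 1 else 0) + countIncl o s

-- Every swap in the sequence that includes o moves o to the right side
-- (o is held by the left agent i and goes to i+1).
AllMoveRight : ∀ {n} {P : Profile n} {σ} → Fin n → SwapSeq P σ → Set
AllMoveRight o start = ⊤
AllMoveRight o (step {σ} s i j _) =
  ((σ i ≡ o ⊎ σ j ≡ o) → σ i ≡ o) × AllMoveRight o s

AllMoveLeft : ∀ {n} {P : Profile n} {σ} → Fin n → SwapSeq P σ → Set
AllMoveLeft o start = ⊤
AllMoveLeft o (step {σ} s i j _) =
  ((σ i ≡ o ⊎ σ j ≡ o) → σ j ≡ o) × AllMoveLeft o s

module Submission where

-- While o sits at agent p with o ≤ p, it has only moved rightwards, once per swap including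
-- it, and every agent b with o ≤ b < p holds an object it prefers to o: b handed o on for
-- something better, and agents only ever improve. So b never takes o back, o cannot move
-- left, and the invariant survives every swap (symmetrically for p ≤ o).

open import Defs
open import Data.Nat using (ℕ; suc; _+_; _≤_; _<_; ∣_-_∣; _≤?_; s≤s; s≤s⁻¹)
open import Data.Nat.Properties
  using (≤-refl; ≤-trans; <⇒≤; 1+n≢n; +-comm; +-suc; ∣-∣-comm; ∣m-m+n∣≡n; <⇒≱; ≰⇒>;
         m≤n⇒m<n∨m≡n)
open import Data.Fin using (Fin; toℕ; _≟_)
open import Data.Fin.Properties using (toℕ-injective)
open import Data.Fin.Permutation.Components using (transpose; transpose-inverse)
open import Data.Bool using (true; false)
open import Data.Empty using (⊥-elim)
open import Data.Product using (_×_; _,_; proj₁; proj₂)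
open import Data.Sum using (_⊎_; inj₁; inj₂; [_,_])
open import Data.Unit using (tt)
open import Function using (_∘_; const)
open import Function.Definitions using (Injective)
open import Relation.Nullary using (does; yes; no; contradiction)
open import Relation.Nullary.Decidable using (dec-true; dec-false)
open import Relation.Binary using (IsStrictTotalOrder)
open import Relation.Binary.PropositionalEquality
  using (_≡_; _≢_; refl; sym; trans; cong; subst; subst₂; module ≡-Reasoning)

∣n-m∣≡c : ∀ {c m n} → c + m ≡ n → ∣ n - m ∣ ≡ c
∣n-m∣≡c {c} {m} refl = begin
  ∣ c + m - m ∣  ≡⟨ ∣-∣-comm (c + m) m ⟩
  ∣ m - c + m ∣  ≡⟨ cong (∣ m -_∣) (+-comm c m) ⟩
  ∣ m - m + c ∣  ≡⟨ ∣m-m+n∣≡n m c ⟩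
  c              ∎
  where open ≡-Reasoning

adjacent⇒≢ : ∀ {n} {i j : Fin n} → Adjacent i j → j ≢ i
adjacent⇒≢ adj refl = 1+n≢n (sym adj)

module _ {n : ℕ} (σ : Assign n) (i j : Fin n) where

  swapAt-left : swapAt σ i j i ≡ σ j
  swapAt-left rewrite dec-true (i ≟ i) refl = refl

  swapAt-right : j ≢ i → swapAt σ i j j ≡ σ i
  swapAt-right j≢i rewrite dec-false (j ≟ i) j≢i | dec-true (j ≟ j) refl = refl

  swapAt≡∘transpose : ∀ k → swapAt σ i j k ≡ σ (transpose i j k)
  swapAt≡∘transpose k with does (k ≟ i)
  ... | true = refl
  ... | false with does (k ≟ j)
  ...   | true  = refl
  ...   | false = refl

reachable-injective : ∀ {n} {P : Profile n} {σ} → SwapSeq P σ → Injective _≡_ _≡_ σ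
reachable-injective start σx≡σy = σx≡σy
reachable-injective (step {σ} s a b _) {x} {y} σ′x≡σ′y = begin
  x                                ≡⟨ sym (transpose-inverse b a) ⟩
  transpose b a (transpose a b x)  ≡⟨ cong (transpose b a) (reachable-injective s σ∘τx≡σ∘τy) ⟩
  transpose b a (transpose a b y)  ≡⟨ transpose-inverse b a ⟩
  y                                ∎
  where
  open ≡-Reasoning
  σ∘τx≡σ∘τy : σ (transpose a b x) ≡ σ (transpose a b y)
  σ∘τx≡σ∘τy = trans (sym (swapAt≡∘transpose σ a b x))
                (trans σ′x≡σ′y (swapAt≡∘transpose σ a b y))

module _ {n : ℕ} (P : Profile n) where

  _≻[_]_ : Fin n → Fin n → Fin n → Set
  x ≻[ a ] y = _prefers_over_ P a x y

  private
    module ≻ (a : Fin n) = IsStrictTotalOrder (strict-linear P a)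

  swap-improves : ∀ {σ a b} → AllowedSwap P σ a b →
                  ∀ x {y} → σ x ≻[ x ] y → swapAt σ a b x ≻[ x ] y
  swap-improves {σ} {a} {b} (adj , a-gains , b-gains) x x-prefers with x ≟ a | x ≟ b
  ... | yes refl | _        = ≻.trans x a-gains x-prefers
  ... | no _     | yes refl = ≻.trans x b-gains x-prefers
  ... | no _     | no _     = x-prefers

  record MovedRight {σ : Assign n} (s : SwapSeq P σ) (o p : Fin n) : Set where
    field
      count  : countIncl o s + toℕ o ≡ toℕ p
      moves  : AllMoveRight o s
      passed : ∀ b → toℕ o ≤ toℕ b → toℕ b < toℕ p → σ b ≻[ b ] o

  record MovedLeft {σ : Assign n} (s : SwapSeq P σ) (o p : Fin n) : Set where
    field
      count  : countIncl o s + toℕ p ≡ toℕ o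
      moves  : AllMoveLeft o s
      passed : ∀ b → toℕ p < toℕ b → toℕ b ≤ toℕ o → σ b ≻[ b ] o

  Invariant : {σ : Assign n} → SwapSeq P σ → Fin n → Fin n → Set
  Invariant s o p = (toℕ o ≤ toℕ p → MovedRight s o p) × (toℕ p ≤ toℕ o → MovedLeft s o p)

  module _ {σ : Assign n} {s : SwapSeq P σ} {a b o : Fin n} (al : AllowedSwap P σ a b) where

    private
      adj : Adjacent a b
      adj = proj₁ al
      a-gains : σ b ≻[ a ] σ a
      a-gains = proj₁ (proj₂ al)
      b-gains : σ a ≻[ b ] σ b
      b-gains = proj₂ (proj₂ al)

      a<b : toℕ a < toℕ b
      a<b = subst (toℕ a <_) (sym adj) ≤-refl


    countIncl-included : σ a ≡ o ⊎ σ b ≡ o → countIncl o (step s a b al) ≡ suc (countIncl o s)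
    countIncl-included (inj₁ σa≡o) rewrite dec-true (σ a ≟ o) σa≡o = refl
    countIncl-included (inj₂ σb≡o) rewrite dec-true (σ b ≟ o) σb≡o with does (σ a ≟ o)
    ... | true  = refl
    ... | false = refl

    countIncl-excluded : σ a ≢ o → σ b ≢ o → countIncl o (step s a b al) ≡ countIncl o s
    countIncl-excluded σa≢o σb≢o rewrite dec-false (σ a ≟ o) σa≢o | dec-false (σ b ≟ o) σb≢o =
      refl

    moved-right-step : σ a ≡ o → MovedRight s o a → MovedRight (step s a b al) o b
    moved-right-step σa≡o r = record
      { count  = begin
          countIncl o (step s a b al) + toℕ o  ≡⟨ cong (_+ toℕ o) (countIncl-included (inj₁ σa≡o)) ⟩
          suc (countIncl o s + toℕ o)          ≡⟨ cong suc (count r) ⟩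
          suc (toℕ a)                          ≡⟨ sym adj ⟩
          toℕ b                                ∎
      ; moves  = const σa≡o , moves r
      ; passed = passed′
      }
      where
      open ≡-Reasoning
      open MovedRight
      passed′ : ∀ x → toℕ o ≤ toℕ x → toℕ x < toℕ b → swapAt σ a b x ≻[ x ] o
      passed′ x o≤x x<b with m≤n⇒m<n∨m≡n (s≤s⁻¹ (subst (toℕ x <_) adj x<b))
      ... | inj₁ x<a = swap-improves al x (passed r x o≤x x<a)
      ... | inj₂ x≡a with toℕ-injective x≡a
      ...   | refl = subst₂ (_≻[ a ]_) (sym (swapAt-left σ a b)) σa≡o a-gains

    moved-left-step : σ b ≡ o → MovedLeft s o b → MovedLeft (step s a b al) o a
    moved-left-step σb≡o l = record
      { count  = begin
          countIncl o (step s a b al) + toℕ a  ≡⟨ cong (_+ toℕ a) (countIncl-included (inj₂ σb≡o)) ⟩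
          suc (countIncl o s) + toℕ a          ≡⟨ sym (+-suc (countIncl o s) (toℕ a)) ⟩
          countIncl o s + suc (toℕ a)          ≡⟨ cong (countIncl o s +_) (sym adj) ⟩
          countIncl o s + toℕ b                ≡⟨ count l ⟩
          toℕ o                                ∎
      ; moves  = const σb≡o , moves l
      ; passed = passed′
      }
      where
      open ≡-Reasoning
      open MovedLeft
      passed′ : ∀ x → toℕ a < toℕ x → toℕ x ≤ toℕ o → swapAt σ a b x ≻[ x ] o
      passed′ x a<x x≤o with m≤n⇒m<n∨m≡n (subst (_≤ toℕ x) (sym adj) a<x)
      ... | inj₁ b<x = swap-improves al x (passed l x b<x x≤o)
      ... | inj₂ b≡x with toℕ-injective b≡x
      ...   | refl = subst₂ (_≻[ b ]_) (sym (swapAt-right σ a b (adjacent⇒≢ adj))) σb≡o b-gains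

    moved-right-idle : σ a ≢ o → σ b ≢ o → ∀ {p} → MovedRight s o p → MovedRight (step s a b al) o p
    moved-right-idle σa≢o σb≢o r = record
      { count  = trans (cong (_+ toℕ o) (countIncl-excluded σa≢o σb≢o)) (count r)
      ; moves  = ⊥-elim ∘ [ σa≢o , σb≢o ] , moves r
      ; passed = λ x o≤x x<p → swap-improves al x (passed r x o≤x x<p)
      }
      where open MovedRight

    moved-left-idle : σ a ≢ o → σ b ≢ o → ∀ {p} → MovedLeft s o p → MovedLeft (step s a b al) o p
    moved-left-idle σa≢o σb≢o l = record
      { count  = trans (cong (_+ _) (countIncl-excluded σa≢o σb≢o)) (count l)
      ; moves  = ⊥-elim ∘ [ σa≢o , σb≢o ] , moves l
      ; passed = λ x p<x x≤o → swap-improves al x (passed l x p<x x≤o)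
      }
      where open MovedLeft

    leftward-swap⇒b≤o : σ b ≡ o → (toℕ o ≤ toℕ b → MovedRight s o b) → toℕ b ≤ toℕ o
    leftward-swap⇒b≤o σb≡o right with toℕ o ≤? toℕ a
    ... | no o≰a  = subst (_≤ toℕ o) (sym adj) (≰⇒> o≰a)
    ... | yes o≤a = ⊥-elim (≻.asym a (subst (_≻[ a ] σ a) σb≡o a-gains) a-keeps)
      where
      a-keeps : σ a ≻[ a ] o
      a-keeps = MovedRight.passed (right (≤-trans o≤a (<⇒≤ a<b))) a o≤a a<b

    rightward-swap⇒o≤a : σ a ≡ o → (toℕ a ≤ toℕ o → MovedLeft s o a) → toℕ o ≤ toℕ a
    rightward-swap⇒o≤a σa≡o left with toℕ b ≤? toℕ o
    ... | no b≰o  = s≤s⁻¹ (subst (toℕ o <_) adj (≰⇒> b≰o))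
    ... | yes b≤o = ⊥-elim (≻.asym b (subst (_≻[ b ] σ b) σa≡o b-gains) b-keeps)
      where
      b-keeps : σ b ≻[ b ] o
      b-keeps = MovedLeft.passed (left (≤-trans (<⇒≤ a<b) b≤o)) b a<b b≤o

  holder-invariant : ∀ {σ} (s : SwapSeq P σ) {o p} → σ p ≡ o → Invariant s o p
  holder-invariant start refl =
      (λ _ → record { count = refl ; moves = tt ; passed = λ _ o≤b b<o → contradiction o≤b (<⇒≱ b<o) })
    , (λ _ → record { count = refl ; moves = tt ; passed = λ _ o<b b≤o → contradiction b≤o (<⇒≱ o<b) })
  -- Matching on p ≟ a and p ≟ b makes swapAt σ a b p compute in the type of the hypothesis.
  holder-invariant (step {σ} s a b al@(adj , _)) {o} {p} _ with p ≟ a | p ≟ b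
  holder-invariant (step {σ} s a b al@(adj , _)) {o} σb≡o | yes refl | _ =
    (λ o≤a → contradiction o≤a (<⇒≱ a<o)) , const (moved-left-step al σb≡o (proj₂ ih b≤o))
    where
    ih : Invariant s o b
    ih = holder-invariant s σb≡o
    b≤o : toℕ b ≤ toℕ o
    b≤o = leftward-swap⇒b≤o al σb≡o (proj₁ ih)
    a<o : toℕ a < toℕ o
    a<o = subst (_≤ toℕ o) adj b≤o
  holder-invariant (step {σ} s a b al@(adj , _)) {o} σa≡o | no _ | yes refl =
    const (moved-right-step al σa≡o (proj₁ ih o≤a)) , (λ b≤o → contradiction b≤o (<⇒≱ o<b))
    where
    ih : Invariant s o a
    ih = holder-invariant s σa≡o
    o≤a : toℕ o ≤ toℕ a
    o≤a = rightward-swap⇒o≤a al σa≡o (proj₂ ih)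
    o<b : toℕ o < toℕ b
    o<b = subst (toℕ o <_) (sym adj) (s≤s o≤a)
  holder-invariant (step {σ} s a b al) {o} {p} σp≡o | no p≢a | no p≢b =
    moved-right-idle al σa≢o σb≢o ∘ proj₁ ih , moved-left-idle al σa≢o σb≢o ∘ proj₂ ih
    where
    ih : Invariant s o p
    ih = holder-invariant s σp≡o
    not-held : ∀ {x} → p ≢ x → σ x ≢ o
    not-held p≢x σx≡o = p≢x (reachable-injective s (trans σp≡o (sym σx≡o)))
    σa≢o : σ a ≢ o
    σa≢o = not-held p≢a
    σb≢o : σ b ≢ o
    σb≢o = not-held p≢b

lemma2 : ∀ {n : ℕ} (P : Profile n) {σ : Assign n} (s : SwapSeq P σ) (i j : Fin n) →
         σ j ≡ i →
         (countIncl i s ≡ ∣ toℕ j - toℕ i ∣)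
         × (toℕ i < toℕ j → AllMoveRight i s)
         × (toℕ j < toℕ i → AllMoveLeft i s)
lemma2 P s i j σj≡i with toℕ i ≤? toℕ j | holder-invariant P s σj≡i
... | yes i≤j | right , _ =
    sym (∣n-m∣≡c (MovedRight.count r))
  , const (MovedRight.moves r)
  , λ j<i → contradiction i≤j (<⇒≱ j<i)
  where
  r : MovedRight P s i j
  r = right i≤j
... | no i≰j | _ , left =
    sym (trans (∣-∣-comm (toℕ j) (toℕ i)) (∣n-m∣≡c (MovedLeft.count l)))
  , (λ i<j → contradiction i<j (i≰j ∘ <⇒≤))
  , const (MovedLeft.moves l)
  where
  l : MovedLeft P s i j
  l = left (<⇒≤ (≰⇒> i≰j))
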